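{- Let $n\ge1$ and let $P_n$ be the path with $n+1$ vertices labelled $1,2,\ldots,n+1$ in order along the path. For a cycle $c$, its multiplicity is the number of orderings of the edges of $P_n$ whose product of edge-transpositions equals $c$. Let $c_0=(1,3,5,\ldots,6,4,2)$ be the $(n+1)$-cycle listing the odd elements of $\{1,\ldots,n+1\}$ in increasing order followed by the even elements in decreasing order. Then among all cycles arising as products of the edges of $P_n$ in some order, $c_0$ and $c_0^{ -1}$ have the highest multiplicity, and every other such cycle has strictly smaller multiplicity.
   Context: Each edge $\{i,j\}$ is regarded as the transposition $(i,j)$; an ordering of the edges lists every edge exactly once, and its product is the product of the corresponding transpositions in that order. -}

module Defs where

open import Data.Nat using (ℕ; zero; suc)
open import Data.Fin using (Fin; zero; suc; toℕ; inject₁; _≟_)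
open import Data.Fin.Properties using () renaming (_≟_ to _≟F_)
open import Data.List using (List; []; _∷_; _++_; concatMap; map; foldr; filter; length; reverse; allFin)
open import Data.Vec using (Vec; tabulate)
open import Data.Vec.Properties using (≡-dec)
open import Data.Bool using (Bool; true; false; if_then_else_)
open import Data.Nat using (_%_)
import Data.Nat
open import Relation.Nullary using (Dec; yes; no; does)
open import Relation.Binary.PropositionalEquality using (_≡_)
open import Function using (_∘_; id)

-- Vertices of the path P_n are Fin (suc n); vertex i (0-based) is the paper's label i+1.
-- Edges of P_n are Fin n; edge k joins vertices k and k+1.

Perm : ℕ → Set
Perm m = Fin m → Fin m

transp : ∀ {m} → Fin m → Fin m → Perm m
transp i j x = if does (x ≟ i) then j else (if does (x ≟ j) then i else x)

edgeT : ∀ {n} → Fin n → Perm (suc n)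
edgeT k = transp (inject₁ k) (suc k)

-- Product of the edge-transpositions in the given order:
-- prod [e1 , e2 , ... , ek] = t_e1 ∘ t_e2 ∘ ... ∘ t_ek  (composition of functions).
prod : ∀ {n} → List (Fin n) → Perm (suc n)
prod = foldr (λ e p → edgeT e ∘ p) id

insertAll : ∀ {A : Set} → A → List A → List (List A)
insertAll x []       = (x ∷ []) ∷ []
insertAll x (y ∷ ys) = (x ∷ y ∷ ys) ∷ map (y ∷_) (insertAll x ys)

orderingsOf : ∀ {A : Set} → List A → List (List A)
orderingsOf []       = [] ∷ []
orderingsOf (x ∷ xs) = concatMap (insertAll x) (orderingsOf xs)

edgeOrderings : ∀ n → List (List (Fin n))
edgeOrderings n = orderingsOf (allFin n)

_≟P_ : ∀ {m} (p q : Perm m) → Dec (tabulate p ≡ tabulate q)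
p ≟P q = ≡-dec _≟F_ (tabulate p) (tabulate q)

mult : ∀ n → Perm (suc n) → ℕ
mult n c = length (filter (λ o → prod o ≟P c) (edgeOrderings n))

Arises : ∀ n → Perm (suc n) → Set
Arises n c = Data.Product.∃ λ o → o Data.List.Membership.Propositional.∈ edgeOrderings n
  Data.Product.× tabulate (prod o) ≡ tabulate c
  where import Data.Product; import Data.List.Membership.Propositional

-- Cycle notation: cycleOf [a1 , ... , ak] sends a_i to a_{i+1}, a_k to a1,
-- and fixes everything else (entries assumed distinct).
nextIn : ∀ {m} → Fin m → Fin m → List (Fin m) → Fin m
nextIn a₁ x []            = x
nextIn a₁ x (a ∷ [])      = if does (x ≟ a) then a₁ else x
nextIn a₁ x (a ∷ b ∷ as)  = if does (x ≟ a) then b else nextIn a₁ x (b ∷ as)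

cycleOf : ∀ {m} → List (Fin m) → Perm m
cycleOf []        x = x
cycleOf (a ∷ as)  x = nextIn a x (a ∷ as)

-- Paper labels 1..n+1: odd labels = 0-based even vertices.
oddLabels : ∀ n → List (Fin (suc n))
oddLabels n = filter (λ v → Data.Nat._≟_ (toℕ v % 2) 0) (allFin (suc n))

evenLabels : ∀ n → List (Fin (suc n))
evenLabels n = filter (λ v → Data.Nat._≟_ (toℕ v % 2) 1) (allFin (suc n))

c0Seq : ∀ n → List (Fin (suc n))
c0Seq n = oddLabels n ++ reverse (evenLabels n)

c0 : ∀ n → Perm (suc n)
c0 n = cycleOf (c0Seq n)

-- Inverse of a permutation: inverse p y = the (first) x with p x = y.
-- (For a bijection p this is the usual inverse.)
findPre : ∀ {m} → Perm m → Fin m → List (Fin m) → Fin m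
findPre p y []       = y
findPre p y (x ∷ xs) = if does (p x ≟ y) then x else findPre p y xs

inverse : ∀ {m} → Perm m → Perm m
inverse {m} p y = findPre p y (allFin m)

-- The product of the edges of P_n in some order is an (n+1)-cycle that depends only on the
-- pattern s recording, for each i, whether edge i comes before edge i + 1: shifting the labels by
-- one and inserting edge 0 splices the new vertex into the cycle just before or just after its
-- neighbour, according to the side of edge 1 on which edge 0 lands. So the multiplicity of a cycle
-- is the number of orderings with its pattern. Refined by the position of edge 0, these numbers obey
-- a boustrophedon recursion: each letter of the pattern replaces the count vector by its tail sums
-- or by its prefix sums. Let α and β be the vectors of the two alternating patterns. Then β is the
-- reflection of α, α is increasing, and with these one proves by induction that every count vector
-- lies pointwise below α or below β, strictly somewhere unless its pattern is alternating.
-- The alternating patterns give exactly c0 and its inverse.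

module Submission where

open import Defs
open import Data.Bool using (Bool; true; false; not; _∧_; if_then_else_)
import Data.Bool as Bool
open import Data.Fin using (Fin; zero; suc; toℕ; inject₁; punchIn)
import Data.Fin as Fin
open import Data.Fin.Properties using (punchIn-injective) renaming (suc-injective to Fin-suc-injective)
open import Data.List using (List; []; _∷_; _++_; map; concatMap; filter; take; drop; length; reverse; allFin)
import Data.List as List
open import Data.List.Properties using (map-∘; map-++; map-tabulate; concatMap-map; map-concatMap; concatMap-cong;
  take++drop≡id; take-map; drop-map; length-++-sucʳ; length-map; length-take; length-++;
  reverse-map; reverse-++; reverse-involutive; unfold-reverse)
open import Data.List.Membership.Propositional using (_∈_; find)
open import Data.List.Membership.Propositional.Properties using (∈-map⁻; ∈-concatMap⁻; ∈-filter⁻; ∈-allFin)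
open import Data.List.Relation.Unary.Any using (here; there)
open import Data.Nat using (ℕ; zero; suc; _+_; _∸_; _⊓_; _%_; _≤_; _<_; _≥_; _≤ᵇ_; z≤n; s≤s; _≤?_; _<?_; _≟_)
open import Data.Nat.DivMod using ([m+n]%n≡m%n)
open import Data.Nat.Properties
open import Data.Product using (Σ-syntax; ∃; _×_; _,_; proj₁; proj₂)
open import Data.Sum using (_⊎_; inj₁; inj₂)
open import Data.Vec using (Vec; []; _∷_; tabulate; lookup)
open import Data.Vec.Properties using (lookup∘tabulate; tabulate-cong)
open import Function using (_∘_)
open import Relation.Binary.PropositionalEquality
open import Relation.Nullary using (¬_; yes; no; does; contradiction)
open import Relation.Nullary.Decidable using (dec-true; dec-false)
open import Relation.Nullary.Reflects using (ofʸ; ofⁿ)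
open import Relation.Unary using (Decidable)
open import Algebra.Properties.CommutativeSemigroup +-commutativeSemigroup using (interchange)

-- Indicators and finite sums

when : Bool → ℕ → ℕ
when b x = if b then x else 0

when-mono-≤ : ∀ b {x y} → x ≤ y → when b x ≤ when b y
when-mono-≤ true  x≤y = x≤y
when-mono-≤ false _   = z≤n

when-comm : ∀ a b x → when a (when b x) ≡ when b (when a x)
when-comm true  true  x = refl
when-comm true  false x = refl
when-comm false true  x = refl
when-comm false false x = refl

when-0 : ∀ b → when b 0 ≡ 0
when-0 true  = refl
when-0 false = refl

when-reverse : ∀ a b c x → when a (when b (when c x)) ≡ when c (when b (when a x))
when-reverse a b c x = begin
  when a (when b (when c x))  ≡⟨ when-comm a b _ ⟩
  when b (when a (when c x))  ≡⟨ cong (when b) (when-comm a c x) ⟩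
  when b (when c (when a x))  ≡⟨ when-comm b c _ ⟩
  when c (when b (when a x))  ∎
  where open ≡-Reasoning

≤ᵇ-true : ∀ {m n} → m ≤ n → (m ≤ᵇ n) ≡ true
≤ᵇ-true {m} {n} m≤n with m ≤ᵇ n | ≤ᵇ-reflects-≤ m n
... | true  | _        = refl
... | false | ofⁿ m≰n = contradiction m≤n m≰n

≤ᵇ-false : ∀ {m n} → n < m → (m ≤ᵇ n) ≡ false
≤ᵇ-false {m} {n} n<m with m ≤ᵇ n | ≤ᵇ-reflects-≤ m n
... | false | _        = refl
... | true  | ofʸ m≤n = contradiction m≤n (<⇒≱ n<m)

≤ᵇ-suc : ∀ p n → (suc p ≤ᵇ suc n) ≡ (p ≤ᵇ n)
≤ᵇ-suc zero    n = refl
≤ᵇ-suc (suc p) n = refl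

does-≟-comm : ∀ m n → does (m ≟ n) ≡ does (n ≟ m)
does-≟-comm m n with m ≟ n
... | yes refl = refl
... | no  m≢n  = trans (dec-false (m ≟ n) m≢n) (sym (dec-false (n ≟ m) (λ n≡m → m≢n (sym n≡m))))

∑ : ℕ → (ℕ → ℕ) → ℕ
∑ zero    f = 0
∑ (suc k) f = ∑ k f + f k

∑-cong : ∀ k {f g} → (∀ j → j < k → f j ≡ g j) → ∑ k f ≡ ∑ k g
∑-cong zero    _ = refl
∑-cong (suc k) h = cong₂ _+_ (∑-cong k (λ j j<k → h j (m≤n⇒m≤1+n j<k))) (h k ≤-refl)

∑-mono-≤ : ∀ k {f g} → (∀ j → j < k → f j ≤ g j) → ∑ k f ≤ ∑ k g
∑-mono-≤ zero    _ = z≤n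
∑-mono-≤ (suc k) h = +-mono-≤ (∑-mono-≤ k (λ j j<k → h j (m≤n⇒m≤1+n j<k))) (h k ≤-refl)

∑-mono-< : ∀ k {f g} → (∀ j → j < k → f j ≤ g j) → ∀ i → i < k → f i < g i → ∑ k f < ∑ k g
∑-mono-< (suc k) h i i<1+k fi<gi with m≤n⇒m<n∨m≡n (≤-pred i<1+k)
... | inj₁ i<k  = +-mono-<-≤ (∑-mono-< k (λ j j<k → h j (m≤n⇒m≤1+n j<k)) i i<k fi<gi) (h k ≤-refl)
... | inj₂ refl = +-mono-≤-< (∑-mono-≤ k (λ j j<k → h j (m≤n⇒m≤1+n j<k))) fi<gi

∑-mono-range : ∀ f {a b} → a ≤ b → ∑ a f ≤ ∑ b f
∑-mono-range f {b = zero}  z≤n = ≤-refl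
∑-mono-range f {b = suc b} a≤1+b with m≤n⇒m<n∨m≡n a≤1+b
... | inj₁ a<1+b = ≤-trans (∑-mono-range f (≤-pred a<1+b)) (m≤m+n _ _)
... | inj₂ refl  = ≤-refl

∑-vanishing : ∀ k {f} → (∀ j → j < k → f j ≡ 0) → ∑ k f ≡ 0
∑-vanishing zero    _ = refl
∑-vanishing (suc k) h = cong₂ _+_ (∑-vanishing k (λ j j<k → h j (m≤n⇒m≤1+n j<k))) (h k ≤-refl)

∑-unfoldˡ : ∀ k f → ∑ (suc k) f ≡ f 0 + ∑ k (λ j → f (suc j))
∑-unfoldˡ zero    f = sym (+-identityʳ _)
∑-unfoldˡ (suc k) f = begin
  ∑ (suc k) f + f (suc k)                  ≡⟨ cong (_+ f (suc k)) (∑-unfoldˡ k f) ⟩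
  f 0 + ∑ k (λ j → f (suc j)) + f (suc k)  ≡⟨ +-assoc (f 0) _ _ ⟩
  f 0 + ∑ (suc k) (λ j → f (suc j))        ∎
  where open ≡-Reasoning

∑-reverse : ∀ k f → ∑ (suc k) f ≡ ∑ (suc k) (λ j → f (k ∸ j))
∑-reverse zero    f = refl
∑-reverse (suc k) f = begin
  ∑ (suc (suc k)) f                                 ≡⟨ ∑-unfoldˡ (suc k) f ⟩
  f 0 + ∑ (suc k) (λ j → f (suc j))                 ≡⟨ cong (f 0 +_) (∑-reverse k (λ j → f (suc j))) ⟩
  f 0 + ∑ (suc k) (λ j → f (suc (k ∸ j)))           ≡⟨ +-comm (f 0) _ ⟩
  ∑ (suc k) (λ j → f (suc (k ∸ j))) + f 0           ≡⟨ cong₂ _+_ (∑-cong (suc k) (λ j j<1+k → cong f (sym (+-∸-assoc 1 (≤-pred j<1+k)))))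
                                                                  (cong f (sym (n∸n≡0 (suc k)))) ⟩
  ∑ (suc (suc k)) (λ j → f (suc k ∸ j))             ∎
  where open ≡-Reasoning

∑-below : ∀ k {l} f → l ≤ k → ∑ k (λ j → when (suc j ≤ᵇ l) (f j)) ≡ ∑ l f
∑-below zero    f z≤n = refl
∑-below (suc k) f l≤1+k with m≤n⇒m<n∨m≡n l≤1+k
... | inj₁ l<1+k = trans (cong₂ _+_ (∑-below k f (≤-pred l<1+k)) (cong (λ b → when b (f k)) (≤ᵇ-false l<1+k)))
                         (+-identityʳ _)
... | inj₂ refl  = ∑-cong (suc k) (λ j j<1+k → cong (λ b → when b (f j)) (≤ᵇ-true j<1+k))

∑≥ : ℕ → ℕ → (ℕ → ℕ) → ℕ
∑≥ q k f = ∑ k (λ j → when (q ≤ᵇ j) (f j))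

∑≥-empty : ∀ q k f → k ≤ q → ∑≥ q k f ≡ 0
∑≥-empty q k f k≤q = ∑-vanishing k (λ j j<k → cong (λ b → when b (f j)) (≤ᵇ-false (<-≤-trans j<k k≤q)))

∑≥-last : ∀ k f → ∑≥ k (suc k) f ≡ f k
∑≥-last k f = cong₂ _+_ (∑≥-empty k k f ≤-refl) (cong (λ b → when b (f k)) (≤ᵇ-true {k} ≤-refl))

∑-split : ∀ q k f → q ≤ k → ∑ q f + ∑≥ q k f ≡ ∑ k f
∑-split q zero    f z≤n = refl
∑-split q (suc k) f q≤1+k with m≤n⇒m<n∨m≡n q≤1+k
... | inj₁ q<1+k = begin
  ∑ q f + (∑≥ q k f + when (q ≤ᵇ k) (f k))  ≡⟨ sym (+-assoc (∑ q f) _ _) ⟩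
  ∑ q f + ∑≥ q k f + when (q ≤ᵇ k) (f k)    ≡⟨ cong₂ _+_ (∑-split q k f (≤-pred q<1+k)) (cong (λ b → when b (f k)) (≤ᵇ-true (≤-pred q<1+k))) ⟩
  ∑ k f + f k                               ∎
  where open ≡-Reasoning
... | inj₂ refl = trans (cong (∑ (suc k) f +_) (∑≥-empty (suc k) (suc k) f ≤-refl)) (+-identityʳ _)

∑≥-mono-≤ : ∀ q k {f g} → (∀ j → f j ≤ g j) → ∑≥ q k f ≤ ∑≥ q k g
∑≥-mono-≤ q k h = ∑-mono-≤ k (λ j _ → when-mono-≤ (q ≤ᵇ j) (h j))

∑≥-mono-< : ∀ q k {f g} → (∀ j → f j ≤ g j) → q < k → f q < g q → ∑≥ q k f < ∑≥ q k g
∑≥-mono-< q k {f} {g} h q<k fq<gq =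
  ∑-mono-< k (λ j _ → when-mono-≤ (q ≤ᵇ j) (h j)) q q<k (subst (λ b → when b (f q) < when b (g q)) (sym (≤ᵇ-true {q} ≤-refl)) fq<gq)

∑-δ : ∀ k i (h : ℕ → ℕ) → ∑ k (λ j → when (does (j ≟ i)) (h j)) ≡ when (suc i ≤ᵇ k) (h i)
∑-δ zero    i h = refl
∑-δ (suc k) i h with k ≟ i
... | yes refl = begin
  ∑ k (λ j → when (does (j ≟ k)) (h j)) + when (does (k ≟ k)) (h k)  ≡⟨ cong₂ _+_ (∑-δ k k h) (cong (λ b → when b (h k)) (dec-true (k ≟ k) refl)) ⟩
  when (suc k ≤ᵇ k) (h k) + h k                                      ≡⟨ cong (λ b → when b (h k) + h k) (≤ᵇ-false (n<1+n k)) ⟩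
  h k                                                                ≡⟨ cong (λ b → when b (h k)) (sym (≤ᵇ-true {suc k} ≤-refl)) ⟩
  when (suc k ≤ᵇ suc k) (h k)                                        ∎
  where open ≡-Reasoning
... | no k≢i = begin
  ∑ k (λ j → when (does (j ≟ i)) (h j)) + when (does (k ≟ i)) (h k)  ≡⟨ cong₂ _+_ (∑-δ k i h) (cong (λ b → when b (h k)) (dec-false (k ≟ i) k≢i)) ⟩
  when (suc i ≤ᵇ k) (h i) + 0                                        ≡⟨ +-identityʳ _ ⟩
  when (suc i ≤ᵇ k) (h i)                                            ≡⟨ cong (λ b → when b (h i)) same-side ⟩
  when (suc i ≤ᵇ suc k) (h i)                                        ∎
  where
  open ≡-Reasoning
  same-side : (suc i ≤ᵇ k) ≡ (suc i ≤ᵇ suc k)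
  same-side with i <? k
  ... | yes i<k = trans (≤ᵇ-true i<k) (sym (≤ᵇ-true (m≤n⇒m≤1+n i<k)))
  ... | no i≮k  = trans (≤ᵇ-false (s≤s (≮⇒≥ i≮k))) (sym (≤ᵇ-false (s≤s (≤∧≢⇒< (≮⇒≥ i≮k) k≢i))))

-- The boustrophedon recursion and its alternating extremes

upper : ℕ → (ℕ → ℕ) → ℕ → ℕ
upper m v q = ∑≥ q (suc m) v

lower : ℕ → (ℕ → ℕ) → ℕ → ℕ
lower m v q = when (q ≤ᵇ suc m) (∑ q v)

-- count s p will be the number of orderings of the edges of P_{m+1} in which edge 0 stands at
-- position p and, for every i < m, edge i precedes edge i + 1 exactly when lookup s i is true.
count : ∀ {m} → Vec Bool m → ℕ → ℕ
count []                  p = when (p ≤ᵇ 0) 1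
count {suc m} (true  ∷ s)   = upper m (count s)
count {suc m} (false ∷ s)   = lower m (count s)

total : ∀ {m} → Vec Bool m → ℕ
total {m} s = ∑ (suc m) (count s)

alternating : Bool → ∀ m → Vec Bool m
alternating b zero    = []
alternating b (suc m) = b ∷ alternating (not b) m

α β : ℕ → ℕ → ℕ
α m = count (alternating false m)
β m = count (alternating true m)

α-suc : ∀ m {q} → q ≤ suc m → α (suc m) q ≡ ∑ q (β m)
α-suc m q≤1+m rewrite ≤ᵇ-true q≤1+m = refl

α-mono : ∀ m {p q} → p ≤ q → q ≤ m → α m p ≤ α m q
α-mono zero    {zero} {zero} _   _     = ≤-refl
α-mono (suc m) {p}    {q}    p≤q q≤1+m rewrite α-suc m (≤-trans p≤q q≤1+m) | α-suc m q≤1+m =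
  ∑-mono-range (β m) p≤q

≤ᵇ-mirror : ∀ k p j → j ≤ k → p ≤ suc k → (p ≤ᵇ k ∸ j) ≡ (suc j ≤ᵇ suc k ∸ p)
≤ᵇ-mirror k p j j≤k p≤1+k with p ≤? k ∸ j
... | yes p≤k∸j = trans (≤ᵇ-true p≤k∸j) (sym (≤ᵇ-true {suc j} (begin
  suc j                    ≡⟨ sym (m∸[m∸n]≡n (s≤s j≤k)) ⟩
  suc k ∸ (suc k ∸ suc j)  ≤⟨ ∸-monoʳ-≤ (suc k) p≤k∸j ⟩
  suc k ∸ p                ∎)))
  where open ≤-Reasoning
... | no p≰k∸j = trans (≤ᵇ-false (≰⇒> p≰k∸j)) (sym (≤ᵇ-false {suc j} (begin-strict
  suc k ∸ p                <⟨ ∸-monoʳ-< (≰⇒> p≰k∸j) p≤1+k ⟩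
  suc k ∸ (k ∸ j)          ≡⟨ +-∸-assoc 1 (m∸n≤m k j) ⟩
  suc (k ∸ (k ∸ j))        ≡⟨ cong suc (m∸[m∸n]≡n j≤k) ⟩
  suc j                    ∎)))
  where open ≤-Reasoning

β-mirror : ∀ m {p} → p ≤ m → β m p ≡ α m (m ∸ p)
β-mirror zero    z≤n = refl
β-mirror (suc k) {p} p≤1+k = begin
  ∑ (suc k) (λ j → when (p ≤ᵇ j) (α k j))                     ≡⟨ ∑-reverse k _ ⟩
  ∑ (suc k) (λ j → when (p ≤ᵇ k ∸ j) (α k (k ∸ j)))           ≡⟨ ∑-cong (suc k) (λ j j<1+k →
       cong₂ when (≤ᵇ-mirror k p j (≤-pred j<1+k) p≤1+k) (sym (β-mirror k (≤-pred j<1+k)))) ⟩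
  ∑ (suc k) (λ j → when (suc j ≤ᵇ suc k ∸ p) (β k j))         ≡⟨ ∑-below (suc k) (β k) (m∸n≤m (suc k) p) ⟩
  ∑ (suc k ∸ p) (β k)                                          ≡⟨ sym (α-suc k (m∸n≤m (suc k) p)) ⟩
  α (suc k) (suc k ∸ p)                                        ∎
  where open ≡-Reasoning

∑α≤∑β : ∀ m q → q ≤ suc m → ∑ q (α m) ≤ ∑ q (β m)
∑α≤∑β m zero    _           = z≤n
∑α≤∑β m (suc q) (s≤s q≤m) = begin
  ∑ (suc q) (α m)                         ≤⟨ ∑-mono-≤ (suc q) (λ j j<1+q →
       α-mono m (j≤m∸[q∸j] j (≤-pred j<1+q)) (m∸n≤m m (q ∸ j))) ⟩
  ∑ (suc q) (λ j → α m (m ∸ (q ∸ j)))     ≡⟨ sym (∑-reverse q (λ j → α m (m ∸ j))) ⟩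
  ∑ (suc q) (λ j → α m (m ∸ j))           ≡⟨ ∑-cong (suc q) (λ j j<1+q → sym (β-mirror m (≤-trans (≤-pred j<1+q) q≤m))) ⟩
  ∑ (suc q) (β m)                         ∎
  where
  open ≤-Reasoning
  j≤m∸[q∸j] : ∀ j → j ≤ q → j ≤ m ∸ (q ∸ j)
  j≤m∸[q∸j] j j≤q = ≤-trans (≤-reflexive (sym (m∸[m∸n]≡n j≤q))) (∸-monoˡ-≤ (q ∸ j) q≤m)

∑β≡∑α : ∀ m → ∑ (suc m) (β m) ≡ ∑ (suc m) (α m)
∑β≡∑α m = trans (∑-cong (suc m) (λ j j<1+m → β-mirror m (≤-pred j<1+m))) (sym (∑-reverse m (α m)))

∑≥β≤∑≥α : ∀ m q → ∑≥ q (suc m) (β m) ≤ ∑≥ q (suc m) (α m)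
∑≥β≤∑≥α m q with q ≤? suc m
... | yes q≤1+m = +-cancelˡ-≤ (∑ q (α m)) _ _ (begin
  ∑ q (α m) + ∑≥ q (suc m) (β m)   ≤⟨ +-monoˡ-≤ _ (∑α≤∑β m q q≤1+m) ⟩
  ∑ q (β m) + ∑≥ q (suc m) (β m)   ≡⟨ ∑-split q (suc m) (β m) q≤1+m ⟩
  ∑ (suc m) (β m)                  ≡⟨ ∑β≡∑α m ⟩
  ∑ (suc m) (α m)                  ≡⟨ sym (∑-split q (suc m) (α m) q≤1+m) ⟩
  ∑ q (α m) + ∑≥ q (suc m) (α m)   ∎)
  where open ≤-Reasoning
... | no q≰1+m = ≤-reflexive (trans (∑≥-empty q (suc m) (β m) (<⇒≤ (≰⇒> q≰1+m)))
                                   (sym (∑≥-empty q (suc m) (α m) (<⇒≤ (≰⇒> q≰1+m)))))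

∑α-positive : ∀ m → 0 < ∑ (suc m) (α m)
∑α-positive zero    = s≤s z≤n
∑α-positive (suc m) = ≤-trans (∑α-positive m) (begin
  ∑ (suc m) (α m)            ≡⟨ sym (∑β≡∑α m) ⟩
  ∑ (suc m) (β m)            ≡⟨ sym (α-suc m ≤-refl) ⟩
  α (suc m) (suc m)          ≤⟨ m≤n+m _ _ ⟩
  ∑ (suc (suc m)) (α (suc m)) ∎)
  where open ≤-Reasoning

_≤ᶠ_ : (ℕ → ℕ) → (ℕ → ℕ) → Set
v ≤ᶠ t = ∀ p → v p ≤ t p

Dominated : ℕ → (ℕ → ℕ) → Set
Dominated m v = v ≤ᶠ α m ⊎ v ≤ᶠ β m

lower-≤ᶠ-α : ∀ m v → Dominated m v → lower m v ≤ᶠ α (suc m)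
lower-≤ᶠ-α m v dom q with q ≤? suc m
... | no q≰1+m rewrite ≤ᵇ-false (≰⇒> q≰1+m) = z≤n
... | yes q≤1+m rewrite ≤ᵇ-true q≤1+m with dom
...   | inj₁ v≤α = ≤-trans (∑-mono-≤ q (λ j _ → v≤α j)) (∑α≤∑β m q q≤1+m)
...   | inj₂ v≤β = ∑-mono-≤ q (λ j _ → v≤β j)

upper-≤ᶠ-β : ∀ m v → Dominated m v → upper m v ≤ᶠ β (suc m)
upper-≤ᶠ-β m v (inj₁ v≤α) q = ∑≥-mono-≤ q (suc m) v≤α
upper-≤ᶠ-β m v (inj₂ v≤β) q = ≤-trans (∑≥-mono-≤ q (suc m) v≤β) (∑≥β≤∑≥α m q)

count-dominated : ∀ {m} (s : Vec Bool m) → Dominated m (count s)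
count-dominated []                  = inj₁ (λ _ → ≤-refl)
count-dominated {suc m} (false ∷ s) = inj₁ (lower-≤ᶠ-α m (count s) (count-dominated s))
count-dominated {suc m} (true  ∷ s) = inj₂ (upper-≤ᶠ-β m (count s) (count-dominated s))

StrictlyBelow : ℕ → (ℕ → ℕ) → (ℕ → ℕ) → Set
StrictlyBelow m v t = v ≤ᶠ t × Σ[ j ∈ ℕ ] (j ≤ m × v j < t j)

StrictlyDominated : ℕ → (ℕ → ℕ) → Set
StrictlyDominated m v = StrictlyBelow m v (α m) ⊎ StrictlyBelow m v (β m)

lower-suc : ∀ m v {j} → j ≤ m → lower m v (suc j) ≡ ∑ (suc j) v
lower-suc m v j≤m rewrite ≤ᵇ-true (s≤s j≤m) = refl

lower-strict : ∀ m v → StrictlyDominated m v → StrictlyBelow (suc m) (lower m v) (α (suc m))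
lower-strict m v (inj₁ (v≤α , j , j≤m , vj<αj)) =
  lower-≤ᶠ-α m v (inj₁ v≤α) , suc j , s≤s j≤m , (begin-strict
    lower m v (suc j)        ≡⟨ lower-suc m v j≤m ⟩
    ∑ (suc j) v              <⟨ ∑-mono-< (suc j) (λ i _ → v≤α i) j ≤-refl vj<αj ⟩
    ∑ (suc j) (α m)          ≤⟨ ∑α≤∑β m (suc j) (s≤s j≤m) ⟩
    ∑ (suc j) (β m)          ≡⟨ sym (lower-suc m (β m) j≤m) ⟩
    α (suc m) (suc j)        ∎)
  where open ≤-Reasoning
lower-strict m v (inj₂ (v≤β , j , j≤m , vj<βj)) =
  lower-≤ᶠ-α m v (inj₂ v≤β) , suc j , s≤s j≤m , (begin-strict
    lower m v (suc j)        ≡⟨ lower-suc m v j≤m ⟩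
    ∑ (suc j) v              <⟨ ∑-mono-< (suc j) (λ i _ → v≤β i) j ≤-refl vj<βj ⟩
    ∑ (suc j) (β m)          ≡⟨ sym (lower-suc m (β m) j≤m) ⟩
    α (suc m) (suc j)        ∎)
  where open ≤-Reasoning

upper-strict : ∀ m v → StrictlyDominated m v → StrictlyBelow (suc m) (upper m v) (β (suc m))
upper-strict m v (inj₁ (v≤α , j , j≤m , vj<αj)) =
  upper-≤ᶠ-β m v (inj₁ v≤α) , j , m≤n⇒m≤1+n j≤m , ∑≥-mono-< j (suc m) v≤α (s≤s j≤m) vj<αj
upper-strict m v (inj₂ (v≤β , j , j≤m , vj<βj)) =
  upper-≤ᶠ-β m v (inj₂ v≤β) , j , m≤n⇒m≤1+n j≤m ,
  <-≤-trans (∑≥-mono-< j (suc m) v≤β (s≤s j≤m) vj<βj) (∑≥β≤∑≥α m j)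

count-ff-strict : ∀ m (s : Vec Bool m) → StrictlyBelow (suc (suc m)) (count (false ∷ false ∷ s)) (α (suc (suc m)))
count-ff-strict m s = lower-≤ᶠ-α (suc m) _ (count-dominated (false ∷ s)) , 1 , s≤s z≤n , ∑α-positive m

count-tt-strict : ∀ m (s : Vec Bool m) → StrictlyBelow (suc (suc m)) (count (true ∷ true ∷ s)) (β (suc (suc m)))
count-tt-strict m s = upper-≤ᶠ-β (suc m) _ (count-dominated (true ∷ s)) , suc m , n≤1+n _ , (begin-strict
  count (true ∷ true ∷ s) (suc m)                   ≡⟨ ∑≥-last (suc m) (count (true ∷ s)) ⟩
  ∑≥ (suc m) (suc m) (count s)                      ≡⟨ ∑≥-empty (suc m) (suc m) (count s) ≤-refl ⟩
  0                                                 <⟨ ∑α-positive m ⟩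
  ∑ (suc m) (α m)                                   ≡⟨ sym (∑β≡∑α m) ⟩
  ∑ (suc m) (β m)                                   ≡⟨ sym (α-suc m ≤-refl) ⟩
  α (suc m) (suc m)                                 ≡⟨ sym (∑≥-last (suc m) (α (suc m))) ⟩
  β (suc (suc m)) (suc m)                           ∎)
  where open ≤-Reasoning

alternating-or-strict : ∀ {m} (s : Vec Bool m) →
  s ≡ alternating false m ⊎ s ≡ alternating true m ⊎ StrictlyDominated m (count s)
alternating-or-strict [] = inj₁ refl
alternating-or-strict {suc m} (b ∷ s) with alternating-or-strict s
alternating-or-strict {suc m}        (true  ∷ s) | inj₁ refl        = inj₂ (inj₁ refl)
alternating-or-strict {suc zero}     (false ∷ s) | inj₁ refl        = inj₁ refl
alternating-or-strict {suc (suc m)}  (false ∷ s) | inj₁ refl        = inj₂ (inj₂ (inj₁ (count-ff-strict m (alternating true m))))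
alternating-or-strict {suc m}        (false ∷ s) | inj₂ (inj₁ refl) = inj₁ refl
alternating-or-strict {suc zero}     (true  ∷ s) | inj₂ (inj₁ refl) = inj₂ (inj₁ refl)
alternating-or-strict {suc (suc m)}  (true  ∷ s) | inj₂ (inj₁ refl) = inj₂ (inj₂ (inj₂ (count-tt-strict m (alternating false m))))
alternating-or-strict {suc m}        (false ∷ s) | inj₂ (inj₂ sd)   = inj₂ (inj₂ (inj₁ (lower-strict m (count s) sd)))
alternating-or-strict {suc m}        (true  ∷ s) | inj₂ (inj₂ sd)   = inj₂ (inj₂ (inj₂ (upper-strict m (count s) sd)))

total-≤ : ∀ {m} (s : Vec Bool m) → total s ≤ total (alternating false m)
total-≤ {m} s with count-dominated s
... | inj₁ c≤α = ∑-mono-≤ (suc m) (λ j _ → c≤α j)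
... | inj₂ c≤β = ≤-trans (∑-mono-≤ (suc m) (λ j _ → c≤β j)) (≤-reflexive (∑β≡∑α m))

total-< : ∀ {m} (s : Vec Bool m) → StrictlyDominated m (count s) → total s < total (alternating false m)
total-< {m} s (inj₁ (c≤α , j , j≤m , cj<αj)) = ∑-mono-< (suc m) (λ i _ → c≤α i) j (s≤s j≤m) cj<αj
total-< {m} s (inj₂ (c≤β , j , j≤m , cj<βj)) =
  <-≤-trans (∑-mono-< (suc m) (λ i _ → c≤β i) j (s≤s j≤m) cj<βj) (≤-reflexive (∑β≡∑α m))

-- Sums over lists and the recursive structure of edge orderings

sumOver : ∀ {A : Set} → (A → ℕ) → List A → ℕ
sumOver F []       = 0
sumOver F (x ∷ xs) = F x + sumOver F xs

sumOver-++ : ∀ {A : Set} (F : A → ℕ) xs ys → sumOver F (xs ++ ys) ≡ sumOver F xs + sumOver F ys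
sumOver-++ F []       ys = refl
sumOver-++ F (x ∷ xs) ys = trans (cong (F x +_) (sumOver-++ F xs ys)) (sym (+-assoc (F x) _ _))

sumOver-map : ∀ {A B : Set} (F : B → ℕ) (f : A → B) xs → sumOver F (map f xs) ≡ sumOver (F ∘ f) xs
sumOver-map F f []       = refl
sumOver-map F f (x ∷ xs) = cong (F (f x) +_) (sumOver-map F f xs)

sumOver-concatMap : ∀ {A B : Set} (F : B → ℕ) (g : A → List B) xs →
  sumOver F (concatMap g xs) ≡ sumOver (sumOver F ∘ g) xs
sumOver-concatMap F g []       = refl
sumOver-concatMap F g (x ∷ xs) = trans (sumOver-++ F (g x) (concatMap g xs)) (cong (sumOver F (g x) +_) (sumOver-concatMap F g xs))

sumOver-cong : ∀ {A : Set} {F G : A → ℕ} xs → (∀ x → x ∈ xs → F x ≡ G x) → sumOver F xs ≡ sumOver G xs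
sumOver-cong []       _ = refl
sumOver-cong (x ∷ xs) h = cong₂ _+_ (h x (here refl)) (sumOver-cong xs (λ y y∈xs → h y (there y∈xs)))

when-sumOver : ∀ {A : Set} a (F : A → ℕ) xs → when a (sumOver F xs) ≡ sumOver (when a ∘ F) xs
when-sumOver true  F xs       = refl
when-sumOver false F []       = refl
when-sumOver false F (x ∷ xs) = when-sumOver false F xs

sumOver-+ : ∀ {A : Set} (F G : A → ℕ) xs → sumOver F xs + sumOver G xs ≡ sumOver (λ x → F x + G x) xs
sumOver-+ F G []       = refl
sumOver-+ F G (x ∷ xs) = trans (interchange (F x) (sumOver F xs) (G x) (sumOver G xs)) (cong (F x + G x +_) (sumOver-+ F G xs))

∑-sumOver : ∀ {A : Set} k (H : A → ℕ → ℕ) xs → ∑ k (λ j → sumOver (λ x → H x j) xs) ≡ sumOver (λ x → ∑ k (H x)) xs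
∑-sumOver zero    H xs = sym (sumOver-0 xs)
  where
  sumOver-0 : ∀ xs → sumOver (λ _ → 0) xs ≡ 0
  sumOver-0 []       = refl
  sumOver-0 (_ ∷ xs) = sumOver-0 xs
∑-sumOver (suc k) H xs = trans (cong (_+ sumOver (λ x → H x k) xs) (∑-sumOver k H xs)) (sumOver-+ (λ x → ∑ k (H x)) (λ x → H x k) xs)

length-filter : ∀ {A : Set} {P : A → Set} (P? : Decidable P) xs → length (filter P? xs) ≡ sumOver (λ x → when (does (P? x)) 1) xs
length-filter P? []       = refl
length-filter P? (x ∷ xs) with does (P? x)
... | true  = cong suc (length-filter P? xs)
... | false = length-filter P? xs

insertAtPos : ∀ {A : Set} → ℕ → A → List A → List A
insertAtPos q x l = take q l ++ x ∷ drop q l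

length-insertAtPos : ∀ {A : Set} q (x : A) l → length (insertAtPos q x l) ≡ suc (length l)
length-insertAtPos q x l = trans (length-++-sucʳ (take q l) x (drop q l)) (cong (suc ∘ length) (take++drop≡id q l))

sumOver-insertAll : ∀ {A : Set} (F : List A → ℕ) x l →
  sumOver F (insertAll x l) ≡ ∑ (suc (length l)) (λ q → F (insertAtPos q x l))
sumOver-insertAll F x []       = +-identityʳ _
sumOver-insertAll F x (y ∷ ys) = begin
  F (x ∷ y ∷ ys) + sumOver F (map (y ∷_) (insertAll x ys))
    ≡⟨ cong (F (x ∷ y ∷ ys) +_) (trans (sumOver-map F (y ∷_) (insertAll x ys)) (sumOver-insertAll (F ∘ (y ∷_)) x ys)) ⟩
  F (x ∷ y ∷ ys) + ∑ (suc (length ys)) (λ q → F (y ∷ insertAtPos q x ys))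
    ≡⟨ sym (∑-unfoldˡ (suc (length ys)) (λ q → F (insertAtPos q x (y ∷ ys)))) ⟩
  ∑ (suc (suc (length ys))) (λ q → F (insertAtPos q x (y ∷ ys)))
    ∎
  where open ≡-Reasoning

∈-insertAll⁻ : ∀ {A : Set} (x : A) l {o} → o ∈ insertAll x l → ∃ λ q → o ≡ insertAtPos q x l
∈-insertAll⁻ x []       (here refl) = 0 , refl
∈-insertAll⁻ x (y ∷ ys) (here refl) = 0 , refl
∈-insertAll⁻ x (y ∷ ys) (there o∈) with ∈-map⁻ (y ∷_) o∈
... | o′ , o′∈ , refl with ∈-insertAll⁻ x ys o′∈
...   | q , refl = suc q , refl

insertAll-map : ∀ {A B : Set} (f : A → B) x ys → insertAll (f x) (map f ys) ≡ map (map f) (insertAll x ys)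
insertAll-map f x []       = refl
insertAll-map f x (y ∷ ys) = cong ((f x ∷ f y ∷ map f ys) ∷_) (begin
  map (f y ∷_) (insertAll (f x) (map f ys))   ≡⟨ cong (map (f y ∷_)) (insertAll-map f x ys) ⟩
  map (f y ∷_) (map (map f) (insertAll x ys)) ≡⟨ sym (map-∘ (insertAll x ys)) ⟩
  map (map f ∘ (y ∷_)) (insertAll x ys)       ≡⟨ map-∘ (insertAll x ys) ⟩
  map (map f) (map (y ∷_) (insertAll x ys))   ∎)
  where open ≡-Reasoning

orderingsOf-map : ∀ {A B : Set} (f : A → B) xs → orderingsOf (map f xs) ≡ map (map f) (orderingsOf xs)
orderingsOf-map f []       = refl
orderingsOf-map f (x ∷ xs) = begin
  concatMap (insertAll (f x)) (orderingsOf (map f xs))        ≡⟨ cong (concatMap (insertAll (f x))) (orderingsOf-map f xs) ⟩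
  concatMap (insertAll (f x)) (map (map f) (orderingsOf xs))  ≡⟨ concatMap-map (insertAll (f x)) (map f) (orderingsOf xs) ⟩
  concatMap (insertAll (f x) ∘ map f) (orderingsOf xs)        ≡⟨ concatMap-cong (insertAll-map f x) (orderingsOf xs) ⟩
  concatMap (map (map f) ∘ insertAll x) (orderingsOf xs)      ≡⟨ sym (map-concatMap (map f) (insertAll x) (orderingsOf xs)) ⟩
  map (map f) (concatMap (insertAll x) (orderingsOf xs))      ∎
  where open ≡-Reasoning

edgeOrderings-suc : ∀ n → edgeOrderings (suc n) ≡ concatMap (insertAll zero ∘ map suc) (edgeOrderings n)
edgeOrderings-suc n = begin
  concatMap (insertAll zero) (orderingsOf (List.tabulate {n = n} suc))
    ≡⟨ cong (concatMap (insertAll zero) ∘ orderingsOf) (sym (map-tabulate {n = n} (λ x → x) suc)) ⟩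
  concatMap (insertAll zero) (orderingsOf (map suc (allFin n)))
    ≡⟨ cong (concatMap (insertAll zero)) (orderingsOf-map suc (allFin n)) ⟩
  concatMap (insertAll zero) (map (map suc) (edgeOrderings n))
    ≡⟨ concatMap-map (insertAll zero) (map suc) (edgeOrderings n) ⟩
  concatMap (insertAll zero ∘ map suc) (edgeOrderings n) ∎
  where open ≡-Reasoning

∈-edgeOrderings-suc⁻ : ∀ n {o} → o ∈ edgeOrderings (suc n) →
  Σ[ w ∈ List (Fin n) ] Σ[ q ∈ ℕ ] (w ∈ edgeOrderings n × o ≡ insertAtPos q zero (map suc w))
∈-edgeOrderings-suc⁻ n o∈ with find (∈-concatMap⁻ (insertAll zero ∘ map suc) (subst (_ ∈_) (edgeOrderings-suc n) o∈))
... | w , w∈ , o∈′ with ∈-insertAll⁻ zero (map suc w) o∈′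
...   | q , refl = w , q , w∈ , refl

position0 : ∀ {k} → List (Fin (suc k)) → ℕ
position0 []          = 0
position0 (zero ∷ _)  = 0
position0 (suc _ ∷ l) = suc (position0 l)

position0-split : ∀ {k} (a : List (Fin k)) b → position0 (map suc a ++ zero ∷ b) ≡ length a
position0-split []      b = refl
position0-split (x ∷ a) b = cong suc (position0-split a b)

insertAtPos-map-suc : ∀ {m} q (w : List (Fin m)) →
  insertAtPos {Fin (suc m)} q zero (map suc w) ≡ map suc (take q w) ++ zero ∷ map suc (drop q w)
insertAtPos-map-suc q w = cong₂ (λ a b → a ++ zero ∷ b) (take-map q w) (drop-map q w)

position0-insertAtPos : ∀ {m} q (w : List (Fin m)) → q ≤ length w → position0 (insertAtPos q zero (map suc w)) ≡ q
position0-insertAtPos q w q≤w = begin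
  position0 (insertAtPos q zero (map suc w))                ≡⟨ cong position0 (insertAtPos-map-suc q w) ⟩
  position0 (map suc (take q w) ++ zero ∷ map suc (drop q w)) ≡⟨ position0-split (take q w) _ ⟩
  length (take q w)                                          ≡⟨ length-take q w ⟩
  q ⊓ length w                                               ≡⟨ m≤n⇒m⊓n≡m q≤w ⟩
  q                                                          ∎
  where open ≡-Reasoning

take-map-prefix : ∀ {A B : Set} (f : A → B) u rest q → q ≤ length u → take q (map f u ++ rest) ≡ map f (take q u)
take-map-prefix f u       rest zero    _         = refl
take-map-prefix f (x ∷ u) rest (suc q) (s≤s q≤u) = cong (f x ∷_) (take-map-prefix f u rest q q≤u)

drop-map-suffix : ∀ {A B : Set} (f : A → B) u y v q → length u < q →
  drop q (map f u ++ y ∷ map f v) ≡ map f (drop (q ∸ suc (length u)) v)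
drop-map-suffix f []      y v (suc q) _         = drop-map q v
drop-map-suffix f (x ∷ u) y v (suc q) (s≤s u<q) = drop-map-suffix f u y v q u<q

-- Products of edge orderings

lift : ∀ {m} → Perm m → Perm (suc m)
lift p zero    = zero
lift p (suc x) = suc (p x)

-- Both operations shift p up by one and splice the new point 0 into its cycle:
-- insertBefore puts 0 right before the shifted point 0, insertAfter right after it.
insertBefore : ∀ {m} → Perm (suc m) → Perm (suc (suc m))
insertBefore p zero    = suc zero
insertBefore p (suc x) = punchIn (suc zero) (p x)

insertAfter : ∀ {m} → Perm (suc m) → Perm (suc (suc m))
insertAfter p zero          = suc (p zero)
insertAfter p (suc zero)    = zero
insertAfter p (suc (suc y)) = suc (p (suc y))

insert : ∀ {m} → Bool → Perm (suc m) → Perm (suc (suc m))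
insert true  = insertBefore
insert false = insertAfter

swap01 : Perm 2
swap01 zero       = suc zero
swap01 (suc zero) = zero

pathCycle : ∀ {m} → Vec Bool m → Perm (suc (suc m))
pathCycle []      = swap01
pathCycle (b ∷ s) = insert b (pathCycle s)

pathCycle-0≢0 : ∀ {m} (s : Vec Bool m) → pathCycle s zero ≢ zero
pathCycle-0≢0 []          ()
pathCycle-0≢0 (true  ∷ s) ()
pathCycle-0≢0 (false ∷ s) ()

insert-cong : ∀ {m} b {p q : Perm (suc m)} → p ≗ q → insert b p ≗ insert b q
insert-cong true  p≗q zero          = refl
insert-cong true  p≗q (suc x)       = cong (punchIn (suc zero)) (p≗q x)
insert-cong false p≗q zero          = cong suc (p≗q zero)
insert-cong false p≗q (suc zero)    = refl
insert-cong false p≗q (suc (suc y)) = cong suc (p≗q (suc y))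

lift-∘ : ∀ {m} (p q : Perm m) → lift p ∘ lift q ≗ lift (p ∘ q)
lift-∘ p q zero    = refl
lift-∘ p q (suc x) = refl

edgeT-suc : ∀ {n} (k : Fin n) → edgeT (suc k) ≗ lift (edgeT k)
edgeT-suc k zero = refl
edgeT-suc k (suc y) with y Fin.≟ inject₁ k
... | yes _ = refl
... | no _ with y Fin.≟ suc k
...   | yes _ = refl
...   | no _  = refl

prod-++ : ∀ {n} (l₁ l₂ : List (Fin n)) → prod (l₁ ++ l₂) ≗ prod l₁ ∘ prod l₂
prod-++ []       l₂ x = refl
prod-++ (e ∷ l₁) l₂ x = cong (edgeT e) (prod-++ l₁ l₂ x)

prod-map-suc : ∀ {n} (l : List (Fin n)) → prod (map suc l) ≗ lift (prod l)
prod-map-suc []      zero    = refl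
prod-map-suc []      (suc x) = refl
prod-map-suc (e ∷ l) x =
  trans (cong (edgeT (suc e)) (prod-map-suc l x)) (trans (edgeT-suc e (lift (prod l) x)) (lift-∘ (edgeT e) (prod l) x))

prod-map-suc² : ∀ {n} (l : List (Fin n)) → prod (map suc (map suc l)) ≗ lift (lift (prod l))
prod-map-suc² l zero    = prod-map-suc (map suc l) zero
prod-map-suc² l (suc x) = trans (prod-map-suc (map suc l) (suc x)) (cong suc (prod-map-suc l x))

-- Here edge 1 (= suc zero) lies right of edge 0; in prod-insertAfter it lies left of it.
prod-insertBefore : ∀ {n} (u : List (Fin n)) (o : List (Fin (suc n))) →
  prod (map suc (map suc u) ++ zero ∷ map suc o) ≗ insertBefore (prod (map suc u ++ o))
prod-insertBefore u o x = trans (prod-++ (map suc (map suc u)) (zero ∷ map suc o) x) (go x)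
  where
  go : ∀ x → prod (map suc (map suc u)) (edgeT zero (prod (map suc o) x)) ≡ insertBefore (prod (map suc u ++ o)) x
  go zero rewrite prod-map-suc o zero | prod-map-suc² u (suc zero) = refl
  go (suc y) rewrite prod-map-suc o (suc y) | prod-++ (map suc u) o y with prod o y
  ... | zero  rewrite prod-map-suc² u zero | prod-map-suc u zero = refl
  ... | suc w rewrite prod-map-suc² u (suc (suc w)) | prod-map-suc u (suc w) = refl

prod-insertAfter : ∀ {n} (o : List (Fin (suc n))) (v : List (Fin n)) →
  prod (map suc o ++ zero ∷ map suc (map suc v)) ≗ insertAfter (prod (o ++ map suc v))
prod-insertAfter o v x = trans (prod-++ (map suc o) (zero ∷ map suc (map suc v)) x) (go x)
  where
  go : ∀ x → prod (map suc o) (edgeT zero (prod (map suc (map suc v)) x)) ≡ insertAfter (prod (o ++ map suc v)) x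
  go zero rewrite prod-map-suc² v zero | prod-map-suc o (suc zero) | prod-++ o (map suc v) zero | prod-map-suc v zero = refl
  go (suc zero) rewrite prod-map-suc² v (suc zero) = prod-map-suc o zero
  go (suc (suc y)) rewrite prod-map-suc² v (suc (suc y)) | prod-map-suc o (suc (suc (prod v y)))
                         | prod-++ o (map suc v) (suc y) | prod-map-suc v (suc y) = refl

-- Edge 0 is inserted before edge 1 exactly when q ≤ length u, the position of edge 1 in the shifted list.
prod-insert0 : ∀ {m} (u v : List (Fin m)) q → let w = map suc u ++ zero ∷ map suc v in
  prod (insertAtPos q zero (map suc w)) ≗ insert (q ≤ᵇ length u) (prod w)
prod-insert0 u v q x with q ≤? length u
... | yes q≤u = begin
  prod (insertAtPos q zero (map suc w)) x
    ≡⟨ cong (λ l → prod l x) (insertAtPos-map-suc q w) ⟩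
  prod (map suc (take q w) ++ zero ∷ map suc (drop q w)) x
    ≡⟨ cong (λ l → prod (map suc l ++ zero ∷ map suc (drop q w)) x) take-w ⟩
  prod (map suc (map suc (take q u)) ++ zero ∷ map suc (drop q w)) x
    ≡⟨ prod-insertBefore (take q u) (drop q w) x ⟩
  insertBefore (prod (map suc (take q u) ++ drop q w)) x
    ≡⟨ cong (λ l → insertBefore (prod l) x) (trans (cong (_++ drop q w) (sym take-w)) (take++drop≡id q w)) ⟩
  insertBefore (prod w) x
    ≡⟨ cong (λ b → insert b (prod w) x) (sym (≤ᵇ-true q≤u)) ⟩
  insert (q ≤ᵇ length u) (prod w) x ∎
  where
  open ≡-Reasoning
  w = map suc u ++ zero ∷ map suc v
  take-w : take q w ≡ map suc (take q u)
  take-w = take-map-prefix suc u (zero ∷ map suc v) q q≤u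
... | no q≰u = begin
  prod (insertAtPos q zero (map suc w)) x
    ≡⟨ cong (λ l → prod l x) (insertAtPos-map-suc q w) ⟩
  prod (map suc (take q w) ++ zero ∷ map suc (drop q w)) x
    ≡⟨ cong (λ l → prod (map suc (take q w) ++ zero ∷ map suc l) x) drop-w ⟩
  prod (map suc (take q w) ++ zero ∷ map suc (map suc v′)) x
    ≡⟨ prod-insertAfter (take q w) v′ x ⟩
  insertAfter (prod (take q w ++ map suc v′)) x
    ≡⟨ cong (λ l → insertAfter (prod l) x) (trans (cong (take q w ++_) (sym drop-w)) (take++drop≡id q w)) ⟩
  insertAfter (prod w) x
    ≡⟨ cong (λ b → insert b (prod w) x) (sym (≤ᵇ-false (≰⇒> q≰u))) ⟩
  insert (q ≤ᵇ length u) (prod w) x ∎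
  where
  open ≡-Reasoning
  w = map suc u ++ zero ∷ map suc v
  v′ = drop (q ∸ suc (length u)) v
  drop-w : drop q w ≡ map suc v′
  drop-w = drop-map-suffix suc u zero v q (≰⇒> q≰u)

record OrderingShape (m : ℕ) (w : List (Fin (suc m))) : Set where
  field
    before after : List (Fin m)
    split        : w ≡ map suc before ++ zero ∷ map suc after
    length≡      : length w ≡ suc m
    signs        : Vec Bool m
    prod≗        : prod w ≗ pathCycle signs

orderingShape : ∀ m {w} → w ∈ edgeOrderings (suc m) → OrderingShape m w
orderingShape zero (here refl) = record
  { before = [] ; after = [] ; split = refl ; length≡ = refl ; signs = [] ; prod≗ = prod≗swap01 }
  where
  prod≗swap01 : prod (zero ∷ []) ≗ swap01
  prod≗swap01 zero       = refl
  prod≗swap01 (suc zero) = refl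
orderingShape (suc m) w∈ with ∈-edgeOrderings-suc⁻ (suc m) w∈
... | w′ , q , w′∈ , refl with orderingShape m w′∈
...   | record { before = u ; after = v ; split = refl ; length≡ = len ; signs = s ; prod≗ = p≗ } = record
  { before  = take q w′
  ; after   = drop q w′
  ; split   = insertAtPos-map-suc q w′
  ; length≡ = trans (length-insertAtPos q zero (map suc w′)) (cong suc (trans (length-map suc w′) len))
  ; signs   = (q ≤ᵇ length u) ∷ s
  ; prod≗   = λ x → trans (prod-insert0 u v q x) (insert-cong (q ≤ᵇ length u) p≗ x)
  }

prod-0≢0 : ∀ {m w} → OrderingShape m w → prod w zero ≢ zero
prod-0≢0 sh eq = pathCycle-0≢0 (OrderingShape.signs sh) (trans (sym (OrderingShape.prod≗ sh zero)) eq)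

position0-≤ : ∀ {m w} → OrderingShape m w → position0 w ≤ m
position0-≤ {m} record { before = u ; after = v ; split = refl ; length≡ = len } = begin
  position0 (map suc u ++ zero ∷ map suc v)  ≡⟨ position0-split u (map suc v) ⟩
  length u                                   ≤⟨ m≤m+n (length u) (length v) ⟩
  length u + length v                        ≡⟨ suc-injective (trans (sym (+-suc (length u) (length v))) length-w) ⟩
  m                                          ∎
  where
  open ≤-Reasoning
  length-w : length u + suc (length v) ≡ suc m
  length-w = trans (cong₂ (λ a b → a + suc b) (sym (length-map suc u)) (sym (length-map suc v)))
                   (trans (sym (length-++ (map suc u))) len)

-- Multiplicities

_≈ᵇ_ : ∀ {k} → Perm k → Perm k → Bool
f ≈ᵇ g = does (f ≟P g)

tabulate-≡⇒≗ : ∀ {k} {f g : Perm k} → tabulate f ≡ tabulate g → f ≗ g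
tabulate-≡⇒≗ {f = f} {g} eq x = trans (sym (lookup∘tabulate f x)) (trans (cong (λ t → lookup t x) eq) (lookup∘tabulate g x))

≈ᵇ-cong : ∀ {k k′} {f g : Perm k} {f′ g′ : Perm k′} → (f ≗ g → f′ ≗ g′) → (f′ ≗ g′ → f ≗ g) → (f ≈ᵇ g) ≡ (f′ ≈ᵇ g′)
≈ᵇ-cong {f = f} {g} {f′} {g′} to from with f ≟P g | f′ ≟P g′
... | yes _     | yes _      = refl
... | no  _     | no  _      = refl
... | yes f≡g   | no  f′≢g′ = contradiction (tabulate-cong (to (tabulate-≡⇒≗ f≡g))) f′≢g′
... | no  f≢g   | yes f′≡g′ = contradiction (tabulate-cong (from (tabulate-≡⇒≗ f′≡g′))) f≢g

≈ᵇ-congˡ : ∀ {k} {f f′ g : Perm k} → f ≗ f′ → (f ≈ᵇ g) ≡ (f′ ≈ᵇ g)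
≈ᵇ-congˡ f≗f′ = ≈ᵇ-cong (λ f≗g x → trans (sym (f≗f′ x)) (f≗g x)) (λ f′≗g x → trans (f≗f′ x) (f′≗g x))

≈ᵇ-congʳ : ∀ {k} {f g g′ : Perm k} → g ≗ g′ → (f ≈ᵇ g) ≡ (f ≈ᵇ g′)
≈ᵇ-congʳ g≗g′ = ≈ᵇ-cong (λ f≗g x → trans (f≗g x) (g≗g′ x)) (λ f≗g′ x → trans (f≗g′ x) (sym (g≗g′ x)))

≉ᵇ : ∀ {k} {f g : Perm k} → ¬ f ≗ g → (f ≈ᵇ g) ≡ false
≉ᵇ {f = f} {g} f≉g = dec-false (f ≟P g) (f≉g ∘ tabulate-≡⇒≗)

punchIn-1≢0 : ∀ {m} (a : Fin (suc m)) → a ≢ zero → punchIn (suc zero) a ≢ zero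
punchIn-1≢0 zero    a≢0 _ = a≢0 refl
punchIn-1≢0 (suc a) _   ()

-- insertAfter q sends 1 to 0, whereas insertBefore p does not when p moves 0.
insert-≈ᵇ : ∀ {m} a b (p q : Perm (suc m)) → p zero ≢ zero → q zero ≢ zero →
  (insert a p ≈ᵇ insert b q) ≡ (does (a Bool.≟ b) ∧ (p ≈ᵇ q))
insert-≈ᵇ true true p q _ _ =
  ≈ᵇ-cong (λ eq x → punchIn-injective (suc zero) (p x) (q x) (eq (suc x))) (insert-cong true)
insert-≈ᵇ false false p q _ _ = ≈ᵇ-cong after⁻¹ (insert-cong false)
  where
  after⁻¹ : insertAfter p ≗ insertAfter q → p ≗ q
  after⁻¹ eq zero    = Fin-suc-injective (eq zero)
  after⁻¹ eq (suc y) = Fin-suc-injective (eq (suc (suc y)))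
insert-≈ᵇ true false p q p0≢0 _ = ≉ᵇ {f = insertBefore p} {insertAfter q} (λ eq → punchIn-1≢0 (p zero) p0≢0 (eq (suc zero)))
insert-≈ᵇ false true p q _ q0≢0 = ≉ᵇ {f = insertAfter p} {insertBefore q} (λ eq → punchIn-1≢0 (q zero) q0≢0 (sym (eq (suc zero))))

hits : ∀ {m} → Perm (suc (suc m)) → ℕ → List (Fin (suc m)) → ℕ
hits c p o = when (does (p ≟ position0 o)) (when (prod o ≈ᵇ c) 1)

orderingsAt : ∀ m → Vec Bool m → ℕ → ℕ
orderingsAt m s p = sumOver (hits (pathCycle s) p) (edgeOrderings (suc m))

-- 1 if edge 0 may stand at position p ≤ m + 1 on side b of edge 1, which stands at position i (b = true: before).
insertionWeight : ℕ → Bool → ℕ → ℕ → ℕ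
insertionWeight m true  p i = when (p ≤ᵇ i) 1
insertionWeight m false p i = when (suc i ≤ᵇ p) (when (p ≤ᵇ suc m) 1)

hits-insert : ∀ {m} b (s : Vec Bool m) p {w} (sh : OrderingShape m w) q → q ≤ length w →
  hits (pathCycle (b ∷ s)) p (insertAtPos q zero (map suc w))
    ≡ when (does (q ≟ p)) (when (does ((q ≤ᵇ length (OrderingShape.before sh)) Bool.≟ b) ∧ (prod w ≈ᵇ pathCycle s)) 1)
hits-insert b s p {w} sh@record { before = u ; after = v ; split = refl } q q≤w =
  cong₂ (λ d e → when d (when e 1))
    (trans (cong (λ i → does (p ≟ i)) (position0-insertAtPos q w q≤w)) (does-≟-comm p q))
    (trans (≈ᵇ-congˡ {g = pathCycle (b ∷ s)} (prod-insert0 u v q))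
           (insert-≈ᵇ (q ≤ᵇ length u) b (prod w) (pathCycle s) (prod-0≢0 sh) (pathCycle-0≢0 s)))

insertionWeight-spec : ∀ m b p i e → i ≤ m →
  when (p ≤ᵇ suc m) (when (does ((p ≤ᵇ i) Bool.≟ b) ∧ e) 1) ≡ when e (insertionWeight m b p i)
insertionWeight-spec m b p i e i≤m with p ≤? i
insertionWeight-spec m true  p i e i≤m | yes p≤i
  rewrite ≤ᵇ-true p≤i | ≤ᵇ-true {p} {suc m} (≤-trans p≤i (m≤n⇒m≤1+n i≤m)) = refl
insertionWeight-spec m false p i e i≤m | yes p≤i
  rewrite ≤ᵇ-true p≤i | ≤ᵇ-true {p} {suc m} (≤-trans p≤i (m≤n⇒m≤1+n i≤m)) | ≤ᵇ-false {suc i} {p} (s≤s p≤i) = sym (when-0 e)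
insertionWeight-spec m true  p i e i≤m | no p≰i
  rewrite ≤ᵇ-false (≰⇒> p≰i) = trans (when-0 (p ≤ᵇ suc m)) (sym (when-0 e))
insertionWeight-spec m false p i e i≤m | no p≰i
  rewrite ≤ᵇ-false (≰⇒> p≰i) | ≤ᵇ-true (≰⇒> p≰i) = when-comm (p ≤ᵇ suc m) e 1

∑-hits-insert : ∀ {m} b (s : Vec Bool m) p {w} → OrderingShape m w →
  ∑ (suc (length w)) (λ q → hits (pathCycle (b ∷ s)) p (insertAtPos q zero (map suc w)))
    ≡ when (prod w ≈ᵇ pathCycle s) (insertionWeight m b p (position0 w))
∑-hits-insert {m} b s p {w} sh@record { before = u ; after = v ; split = refl ; length≡ = len } = begin
  ∑ (suc (length w)) (λ q → hits (pathCycle (b ∷ s)) p (insertAtPos q zero (map suc w)))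
    ≡⟨ ∑-cong (suc (length w)) (λ q q<1+w →
         hits-insert b s p sh q (≤-pred q<1+w)) ⟩
  ∑ (suc (length w)) (λ q → when (does (q ≟ p)) (weight q))
    ≡⟨ ∑-δ (suc (length w)) p weight ⟩
  when (suc p ≤ᵇ suc (length w)) (weight p)
    ≡⟨ cong (λ b → when b (weight p)) (trans (≤ᵇ-suc p _) (cong (p ≤ᵇ_) len)) ⟩
  when (p ≤ᵇ suc m) (weight p)
    ≡⟨ insertionWeight-spec m b p (length u) e (subst (_≤ m) (position0-split u (map suc v)) (position0-≤ sh)) ⟩
  when e (insertionWeight m b p (length u))
    ≡⟨ cong (when e ∘ insertionWeight m b p) (sym (position0-split u (map suc v))) ⟩
  when e (insertionWeight m b p (position0 w))
    ∎
  where
  open ≡-Reasoning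
  e = prod w ≈ᵇ pathCycle s
  weight : ℕ → ℕ
  weight q = when (does ((q ≤ᵇ length u) Bool.≟ b) ∧ e) 1

orderingsAt-suc : ∀ m b (s : Vec Bool m) p →
  orderingsAt (suc m) (b ∷ s) p
    ≡ sumOver (λ w → when (prod w ≈ᵇ pathCycle s) (insertionWeight m b p (position0 w))) (edgeOrderings (suc m))
orderingsAt-suc m b s p = begin
  sumOver F (edgeOrderings (suc (suc m)))
    ≡⟨ cong (sumOver F) (edgeOrderings-suc (suc m)) ⟩
  sumOver F (concatMap (insertAll zero ∘ map suc) (edgeOrderings (suc m)))
    ≡⟨ sumOver-concatMap F (insertAll zero ∘ map suc) (edgeOrderings (suc m)) ⟩
  sumOver (λ w → sumOver F (insertAll zero (map suc w))) (edgeOrderings (suc m))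
    ≡⟨ sumOver-cong (edgeOrderings (suc m)) (λ w w∈ →
         trans (sumOver-insertAll F zero (map suc w))
               (trans (cong (λ n → ∑ (suc n) (λ q → F (insertAtPos q zero (map suc w)))) (length-map suc w))
                      (∑-hits-insert b s p (orderingShape m w∈)))) ⟩
  sumOver (λ w → when (prod w ≈ᵇ pathCycle s) (insertionWeight m b p (position0 w))) (edgeOrderings (suc m))
    ∎
  where
  open ≡-Reasoning
  F = hits (pathCycle (b ∷ s)) p

∑-hits : ∀ {m} c (w : List (Fin (suc m))) → position0 w ≤ m → ∑ (suc m) (λ j → hits c j w) ≡ when (prod w ≈ᵇ c) 1
∑-hits c w i≤m = trans (∑-δ _ (position0 w) (λ _ → when (prod w ≈ᵇ c) 1)) (cong (λ b → when b (when (prod w ≈ᵇ c) 1)) (≤ᵇ-true (s≤s i≤m)))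

∑-hits-above : ∀ {m} c p (w : List (Fin (suc m))) → position0 w ≤ m →
  ∑ (suc m) (λ j → when (p ≤ᵇ j) (hits c j w)) ≡ when (prod w ≈ᵇ c) (insertionWeight m true p (position0 w))
∑-hits-above {m} c p w i≤m = begin
  ∑ (suc m) (λ j → when (p ≤ᵇ j) (hits c j w))                          ≡⟨ ∑-cong (suc m) (λ j _ → when-comm (p ≤ᵇ j) (does (j ≟ i)) (when e 1)) ⟩
  ∑ (suc m) (λ j → when (does (j ≟ i)) (when (p ≤ᵇ j) (when e 1)))      ≡⟨ ∑-δ (suc m) i (λ j → when (p ≤ᵇ j) (when e 1)) ⟩
  when (suc i ≤ᵇ suc m) (when (p ≤ᵇ i) (when e 1))                      ≡⟨ cong (λ b → when b (when (p ≤ᵇ i) (when e 1))) (≤ᵇ-true (s≤s i≤m)) ⟩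
  when (p ≤ᵇ i) (when e 1)                                              ≡⟨ when-comm (p ≤ᵇ i) e 1 ⟩
  when e (when (p ≤ᵇ i) 1)                                              ∎
  where
  open ≡-Reasoning
  i = position0 w
  e = prod w ≈ᵇ c

∑-hits-below : ∀ {m} c p (w : List (Fin (suc m))) →
  when (p ≤ᵇ suc m) (∑ p (λ j → hits c j w)) ≡ when (prod w ≈ᵇ c) (insertionWeight m false p (position0 w))
∑-hits-below {m} c p w =
  trans (cong (when (p ≤ᵇ suc m)) (∑-δ p (position0 w) (λ _ → when e 1))) (when-reverse (p ≤ᵇ suc m) (suc (position0 w) ≤ᵇ p) e 1)
  where e = prod w ≈ᵇ c

count-suc : ∀ m b (s : Vec Bool m) p → (∀ j → count s j ≡ orderingsAt m s j) →
  count (b ∷ s) p ≡ sumOver (λ w → when (prod w ≈ᵇ pathCycle s) (insertionWeight m b p (position0 w))) (edgeOrderings (suc m))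
count-suc m true s p ih = begin
  ∑ (suc m) (λ j → when (p ≤ᵇ j) (count s j))                    ≡⟨ ∑-cong (suc m) (λ j _ →
       trans (cong (when (p ≤ᵇ j)) (ih j)) (when-sumOver (p ≤ᵇ j) (hits c j) E)) ⟩
  ∑ (suc m) (λ j → sumOver (λ w → when (p ≤ᵇ j) (hits c j w)) E)  ≡⟨ ∑-sumOver (suc m) (λ w j → when (p ≤ᵇ j) (hits c j w)) E ⟩
  sumOver (λ w → ∑ (suc m) (λ j → when (p ≤ᵇ j) (hits c j w))) E  ≡⟨ sumOver-cong E (λ w w∈ →
       ∑-hits-above c p w (position0-≤ (orderingShape m w∈))) ⟩
  sumOver (λ w → when (prod w ≈ᵇ c) (insertionWeight m true p (position0 w))) E ∎
  where
  open ≡-Reasoning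
  c = pathCycle s
  E = edgeOrderings (suc m)
count-suc m false s p ih = begin
  when (p ≤ᵇ suc m) (∑ p (count s))                                ≡⟨ cong (when (p ≤ᵇ suc m)) (∑-cong p (λ j _ → ih j)) ⟩
  when (p ≤ᵇ suc m) (∑ p (λ j → sumOver (hits c j) E))             ≡⟨ cong (when (p ≤ᵇ suc m)) (∑-sumOver p (λ w j → hits c j w) E) ⟩
  when (p ≤ᵇ suc m) (sumOver (λ w → ∑ p (λ j → hits c j w)) E)     ≡⟨ when-sumOver (p ≤ᵇ suc m) _ E ⟩
  sumOver (λ w → when (p ≤ᵇ suc m) (∑ p (λ j → hits c j w))) E     ≡⟨ sumOver-cong E (λ w _ → ∑-hits-below c p w) ⟩
  sumOver (λ w → when (prod w ≈ᵇ c) (insertionWeight m false p (position0 w))) E ∎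
  where
  open ≡-Reasoning
  c = pathCycle s
  E = edgeOrderings (suc m)

count≡orderingsAt : ∀ m (s : Vec Bool m) p → count s p ≡ orderingsAt m s p
count≡orderingsAt zero    []      zero    = refl
count≡orderingsAt zero    []      (suc p) = refl
count≡orderingsAt (suc m) (b ∷ s) p       =
  trans (count-suc m b s p (count≡orderingsAt m s)) (sym (orderingsAt-suc m b s p))

mult≡total : ∀ m {c} (s : Vec Bool m) → c ≗ pathCycle s → mult (suc m) c ≡ total s
mult≡total m {c} s c≗s = begin
  length (filter (λ o → prod o ≟P c) E)                   ≡⟨ length-filter (λ o → prod o ≟P c) E ⟩
  sumOver (λ o → when (prod o ≈ᵇ c) 1) E                  ≡⟨ sumOver-cong E (λ o o∈ →
       trans (cong (λ b → when b 1) (≈ᵇ-congʳ {f = prod o} c≗s))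
             (sym (∑-hits (pathCycle s) o (position0-≤ (orderingShape m o∈))))) ⟩
  sumOver (λ o → ∑ (suc m) (λ j → hits (pathCycle s) j o)) E ≡⟨ sym (∑-sumOver (suc m) (λ o j → hits (pathCycle s) j o) E) ⟩
  ∑ (suc m) (orderingsAt m s)                             ≡⟨ ∑-cong (suc m) (λ j _ → sym (count≡orderingsAt m s j)) ⟩
  total s                                                 ∎
  where
  open ≡-Reasoning
  E = edgeOrderings (suc m)

arises⇒pathCycle : ∀ m {c} → Arises (suc m) c → Σ[ s ∈ Vec Bool m ] c ≗ pathCycle s
arises⇒pathCycle m {c} (o , o∈ , o≡c) =
  OrderingShape.signs sh , λ x → trans (sym (tabulate-≡⇒≗ {f = prod o} {c} o≡c x)) (OrderingShape.prod≗ sh x)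
  where sh = orderingShape m o∈

mult-positive⇒arises : ∀ n c → 0 < mult n c → Arises n c
mult-positive⇒arises n c 0<mult with filter (λ o → prod o ≟P c) (edgeOrderings n) in eq
... | o ∷ _ with ∈-filter⁻ (λ o → prod o ≟P c) (subst (o ∈_) (sym eq) (here refl))
...   | o∈ , o≡c = o , o∈ , o≡c

-- The cycle c0 and its inverse

[2+t]%2≡t%2 : ∀ t → suc (suc t) % 2 ≡ t % 2
[2+t]%2≡t%2 t = trans (cong (_% 2) (+-comm 2 t)) ([m+n]%n≡m%n t 2)

parity : ∀ t → (t % 2 ≡ 0 × suc t % 2 ≡ 1) ⊎ (t % 2 ≡ 1 × suc t % 2 ≡ 0)
parity zero    = inj₁ (refl , refl)
parity (suc t) with parity t
... | inj₁ (t≡0 , 1+t≡1) = inj₂ (1+t≡1 , trans ([2+t]%2≡t%2 t) t≡0)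
... | inj₂ (t≡1 , 1+t≡0) = inj₁ (1+t≡0 , trans ([2+t]%2≡t%2 t) t≡1)

hasParity : ∀ {k} r → Decidable (λ (v : Fin k) → toℕ v % 2 ≡ r)
hasParity r v = toℕ v % 2 ≟ r

hasParity-suc : ∀ {k} (v : Fin k) → does (hasParity 0 (suc v)) ≡ does (hasParity 1 v) × does (hasParity 1 (suc v)) ≡ does (hasParity 0 v)
hasParity-suc v with parity (toℕ v)
... | inj₁ (v≡0 , 1+v≡1) rewrite v≡0 | 1+v≡1 = refl , refl
... | inj₂ (v≡1 , 1+v≡0) rewrite v≡1 | 1+v≡0 = refl , refl

filter-map : ∀ {A B : Set} (f : A → B) {P : B → Set} {Q : A → Set} (P? : Decidable P) (Q? : Decidable Q) →
  (∀ v → does (P? (f v)) ≡ does (Q? v)) → ∀ l → filter P? (map f l) ≡ map f (filter Q? l)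
filter-map f P? Q? same []      = refl
filter-map f P? Q? same (v ∷ l) with does (P? (f v)) | does (Q? v) | same v
... | true  | true  | _ = cong (f v ∷_) (filter-map f P? Q? same l)
... | false | false | _ = filter-map f P? Q? same l

allFin-suc : ∀ n → allFin (suc (suc n)) ≡ zero ∷ map suc (allFin (suc n))
allFin-suc n = cong (zero ∷_) (sym (map-tabulate {n = suc n} (λ x → x) suc))

oddLabels-suc : ∀ n → oddLabels (suc n) ≡ zero ∷ map suc (evenLabels n)
oddLabels-suc n = trans (cong (filter (hasParity 0)) (allFin-suc n))
                        (cong (zero ∷_) (filter-map suc (hasParity 0) (hasParity 1) (proj₁ ∘ hasParity-suc) (allFin (suc n))))

evenLabels-suc : ∀ n → evenLabels (suc n) ≡ map suc (oddLabels n)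
evenLabels-suc n = trans (cong (filter (hasParity 1)) (allFin-suc n))
                         (filter-map suc (hasParity 1) (hasParity 0) (proj₂ ∘ hasParity-suc) (allFin (suc n)))

c0Seq-suc : ∀ n → c0Seq (suc n) ≡ zero ∷ map suc (reverse (c0Seq n))
c0Seq-suc n = begin
  oddLabels (suc n) ++ reverse (evenLabels (suc n))
    ≡⟨ cong₂ (λ a b → a ++ reverse b) (oddLabels-suc n) (evenLabels-suc n) ⟩
  zero ∷ map suc (evenLabels n) ++ reverse (map suc (oddLabels n))
    ≡⟨ cong (λ t → zero ∷ map suc (evenLabels n) ++ t) (sym (reverse-map suc (oddLabels n))) ⟩
  zero ∷ map suc (evenLabels n) ++ map suc (reverse (oddLabels n))
    ≡⟨ cong (zero ∷_) (sym (map-++ suc (evenLabels n) _)) ⟩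
  zero ∷ map suc (evenLabels n ++ reverse (oddLabels n))
    ≡⟨ cong (λ t → zero ∷ map suc (t ++ reverse (oddLabels n))) (sym (reverse-involutive (evenLabels n))) ⟩
  zero ∷ map suc (reverse (reverse (evenLabels n)) ++ reverse (oddLabels n))
    ≡⟨ cong (λ t → zero ∷ map suc t) (sym (reverse-++ (oddLabels n) (reverse (evenLabels n)))) ⟩
  zero ∷ map suc (reverse (c0Seq n)) ∎
  where open ≡-Reasoning

reverse-c0Seq-suc : ∀ n → reverse (c0Seq (suc n)) ≡ map suc (c0Seq n) ++ zero ∷ []
reverse-c0Seq-suc n = begin
  reverse (c0Seq (suc n))                             ≡⟨ cong reverse (c0Seq-suc n) ⟩
  reverse (zero ∷ map suc (reverse (c0Seq n)))        ≡⟨ unfold-reverse zero (map suc (reverse (c0Seq n))) ⟩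
  reverse (map suc (reverse (c0Seq n))) ++ zero ∷ []  ≡⟨ cong (_++ zero ∷ []) (sym (reverse-map suc (reverse (c0Seq n)))) ⟩
  map suc (reverse (reverse (c0Seq n))) ++ zero ∷ []  ≡⟨ cong (λ t → map suc t ++ zero ∷ []) (reverse-involutive (c0Seq n)) ⟩
  map suc (c0Seq n) ++ zero ∷ []                      ∎
  where open ≡-Reasoning

nextIn-skip : ∀ {m} (a x c : Fin m) l → x ≢ c → nextIn a x (c ∷ l) ≡ nextIn a x l
nextIn-skip a x c []      x≢c with x Fin.≟ c
... | yes x≡c = contradiction x≡c x≢c
... | no  _   = refl
nextIn-skip a x c (d ∷ l) x≢c with x Fin.≟ c
... | yes x≡c = contradiction x≡c x≢c
... | no  _   = refl

nextIn-last : ∀ {k k′} (f : Fin k → Fin k′) (x a : Fin k′) l → (∀ y → f y ≢ x) → nextIn a x (map f l ++ x ∷ []) ≡ a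
nextIn-last f x a []      _ with x Fin.≟ x
... | yes _   = refl
... | no  x≢x = contradiction refl x≢x
nextIn-last f x a (y ∷ l) fy≢x =
  trans (nextIn-skip a x (f y) (map f l ++ x ∷ []) (fy≢x y ∘ sym)) (nextIn-last f x a l fy≢x)

nextIn-map-suc : ∀ {m} (a x : Fin m) l → nextIn (suc a) (suc x) (map suc l) ≡ suc (nextIn a x l)
nextIn-map-suc a x []          = refl
nextIn-map-suc a x (c ∷ [])    with x Fin.≟ c
... | yes _ = refl
... | no  _ = refl
nextIn-map-suc a x (c ∷ d ∷ l) with x Fin.≟ c | nextIn-map-suc a x (d ∷ l)
... | yes _ | _  = refl
... | no  _ | ih = ih

nextIn-first : ∀ {m} (a a′ x b : Fin m) l → x ≢ b → nextIn a x (l ++ b ∷ []) ≡ nextIn a′ x (l ++ b ∷ [])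
nextIn-first a a′ x b []          x≢b with x Fin.≟ b
... | yes x≡b = contradiction x≡b x≢b
... | no  _   = refl
nextIn-first a a′ x b (c ∷ [])    x≢b with x Fin.≟ c
... | yes _ = refl
... | no  _ = nextIn-first a a′ x b [] x≢b
nextIn-first a a′ x b (c ∷ d ∷ l) x≢b with x Fin.≟ c | nextIn-first a a′ x b (d ∷ l) x≢b
... | yes _ | _  = refl
... | no  _ | ih = ih

nextIn-punchIn : ∀ {k} (l : List (Fin (suc k))) y →
  nextIn (suc zero) (suc (suc y)) (map suc (map suc l) ++ zero ∷ []) ≡ punchIn (suc zero) (nextIn zero (suc y) (map suc l))
nextIn-punchIn []          y = refl
nextIn-punchIn (c ∷ [])    y with y Fin.≟ c
... | yes _ = refl
... | no  _ = refl
nextIn-punchIn (c ∷ d ∷ l) y with y Fin.≟ c | nextIn-punchIn (d ∷ l) y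
... | yes _ | _  = refl
... | no  _ | ih = ih

head-or : ∀ {A : Set} → List A → A → A
head-or []      b = b
head-or (c ∷ _) _ = c

cycleOf-snoc : ∀ {m} (l : List (Fin m)) b x → cycleOf (l ++ b ∷ []) x ≡ nextIn (head-or l b) x (l ++ b ∷ [])
cycleOf-snoc []      b x = refl
cycleOf-snoc (c ∷ l) b x = refl

suc≢0 : ∀ {k} (y : Fin k) → Fin.suc y ≢ zero
suc≢0 y ()

suc-suc≢1 : ∀ {k} (y : Fin k) → Fin.suc (Fin.suc y) ≢ suc zero
suc-suc≢1 y ()

cycleOf-insertAfter : ∀ {k} (l : List (Fin (suc k))) →
  cycleOf (zero ∷ map suc (map suc l ++ zero ∷ [])) ≗ insertAfter (cycleOf (map suc l ++ zero ∷ []))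
cycleOf-insertAfter []      zero = refl
cycleOf-insertAfter (c ∷ l) zero = sym (cong suc (trans
  (nextIn-skip (suc c) zero (suc c) (map suc l ++ zero ∷ []) (λ ()))
  (nextIn-last suc zero (suc c) l suc≢0)))
cycleOf-insertAfter l (suc zero) = begin
  nextIn zero (suc zero) (zero ∷ map suc (map suc l ++ zero ∷ []))
    ≡⟨ nextIn-skip zero (suc zero) zero (map suc (map suc l ++ zero ∷ [])) (λ ()) ⟩
  nextIn zero (suc zero) (map suc (map suc l ++ zero ∷ []))
    ≡⟨ cong (nextIn zero (suc zero)) (trans (map-++ suc (map suc l) (zero ∷ [])) (cong (_++ suc zero ∷ []) (sym (map-∘ l)))) ⟩
  nextIn zero (suc zero) (map (λ y → suc (suc y)) l ++ suc zero ∷ [])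
    ≡⟨ nextIn-last (λ y → suc (suc y)) (suc zero) zero l suc-suc≢1 ⟩
  zero ∎
  where open ≡-Reasoning
cycleOf-insertAfter l (suc (suc y)) = begin
  nextIn zero (suc (suc y)) (zero ∷ map suc (map suc l ++ zero ∷ []))
    ≡⟨ nextIn-skip zero (suc (suc y)) zero (map suc (map suc l ++ zero ∷ [])) (λ ()) ⟩
  nextIn zero (suc (suc y)) (map suc (map suc l ++ zero ∷ []))
    ≡⟨ cong (nextIn zero (suc (suc y))) (map-++ suc (map suc l) (zero ∷ [])) ⟩
  nextIn zero (suc (suc y)) (map suc (map suc l) ++ suc zero ∷ [])
    ≡⟨ nextIn-first zero (suc h) (suc (suc y)) (suc zero) (map suc (map suc l)) (suc-suc≢1 y) ⟩
  nextIn (suc h) (suc (suc y)) (map suc (map suc l) ++ suc zero ∷ [])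
    ≡⟨ cong (nextIn (suc h) (suc (suc y))) (sym (map-++ suc (map suc l) (zero ∷ []))) ⟩
  nextIn (suc h) (suc (suc y)) (map suc (map suc l ++ zero ∷ []))
    ≡⟨ nextIn-map-suc h (suc y) (map suc l ++ zero ∷ []) ⟩
  suc (nextIn h (suc y) (map suc l ++ zero ∷ []))
    ≡⟨ cong suc (sym (cycleOf-snoc (map suc l) zero (suc y))) ⟩
  suc (cycleOf (map suc l ++ zero ∷ []) (suc y)) ∎
  where
  open ≡-Reasoning
  h = head-or (map suc l) zero

cycleOf-insertBefore : ∀ {k} (l : List (Fin (suc k))) →
  cycleOf (map suc (zero ∷ map suc l) ++ zero ∷ []) ≗ insertBefore (cycleOf (zero ∷ map suc l))
cycleOf-insertBefore l       zero          = nextIn-last suc zero (suc zero) (zero ∷ map suc l) suc≢0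
cycleOf-insertBefore []      (suc zero)    = refl
cycleOf-insertBefore (c ∷ l) (suc zero)    = refl
cycleOf-insertBefore l       (suc (suc y)) =
  trans (nextIn-skip (suc zero) (suc (suc y)) (suc zero) (map suc (map suc l) ++ zero ∷ []) (λ ()))
        (trans (nextIn-punchIn l y) (cong (punchIn (suc zero)) (sym (nextIn-skip zero (suc y) zero (map suc l) (λ ())))))

c0-pathCycle : ∀ m → cycleOf (c0Seq (suc m)) ≗ pathCycle (alternating false m)
                   × cycleOf (reverse (c0Seq (suc m))) ≗ pathCycle (alternating true m)
c0-pathCycle zero = c0-1 , c0⁻¹-1
  where
  c0-1 : cycleOf (c0Seq 1) ≗ swap01
  c0-1 zero       = refl
  c0-1 (suc zero) = refl
  c0⁻¹-1 : cycleOf (reverse (c0Seq 1)) ≗ swap01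
  c0⁻¹-1 zero       = refl
  c0⁻¹-1 (suc zero) = refl
c0-pathCycle (suc m) = forward , backward
  where
  open ≡-Reasoning
  forward : cycleOf (c0Seq (suc (suc m))) ≗ pathCycle (alternating false (suc m))
  forward x = begin
    cycleOf (c0Seq (suc (suc m))) x
      ≡⟨ cong (λ l → cycleOf l x) (trans (c0Seq-suc (suc m)) (cong (λ t → zero ∷ map suc t) (reverse-c0Seq-suc m))) ⟩
    cycleOf (zero ∷ map suc (map suc (c0Seq m) ++ zero ∷ [])) x
      ≡⟨ cycleOf-insertAfter (c0Seq m) x ⟩
    insertAfter (cycleOf (map suc (c0Seq m) ++ zero ∷ [])) x
      ≡⟨ insert-cong false (λ y → trans (cong (λ l → cycleOf l y) (sym (reverse-c0Seq-suc m))) (proj₂ (c0-pathCycle m) y)) x ⟩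
    insertAfter (pathCycle (alternating true m)) x ∎
  backward : cycleOf (reverse (c0Seq (suc (suc m)))) ≗ pathCycle (alternating true (suc m))
  backward x = begin
    cycleOf (reverse (c0Seq (suc (suc m)))) x
      ≡⟨ cong (λ l → cycleOf l x) (trans (reverse-c0Seq-suc (suc m)) (cong (λ t → map suc t ++ zero ∷ []) (c0Seq-suc m))) ⟩
    cycleOf (map suc (zero ∷ map suc (reverse (c0Seq m))) ++ zero ∷ []) x
      ≡⟨ cycleOf-insertBefore (reverse (c0Seq m)) x ⟩
    insertBefore (cycleOf (zero ∷ map suc (reverse (c0Seq m)))) x
      ≡⟨ insert-cong true (λ y → trans (cong (λ l → cycleOf l y) (sym (c0Seq-suc m))) (proj₁ (c0-pathCycle m) y)) x ⟩
    insertBefore (pathCycle (alternating false m)) x ∎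

insertAfter∘insertBefore : ∀ {k} (p q : Perm (suc k)) → (∀ x → p (q x) ≡ x) → ∀ x → insertAfter p (insertBefore q x) ≡ x
insertAfter∘insertBefore p q pq≗id zero    = refl
insertAfter∘insertBefore p q pq≗id (suc y) with q y | pq≗id y
... | zero  | eq = cong suc eq
... | suc _ | eq = cong suc eq

insertBefore∘insertAfter : ∀ {k} (p q : Perm (suc k)) → (∀ x → p (q x) ≡ x) → ∀ x → insertBefore p (insertAfter q x) ≡ x
insertBefore∘insertAfter p q pq≗id zero          rewrite pq≗id zero = refl
insertBefore∘insertAfter p q pq≗id (suc zero)    = refl
insertBefore∘insertAfter p q pq≗id (suc (suc y)) rewrite pq≗id (suc y) = refl

pathCycle-alternating-inverse : ∀ m →
  (∀ x → pathCycle (alternating false m) (pathCycle (alternating true m) x) ≡ x) ×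
  (∀ x → pathCycle (alternating true m) (pathCycle (alternating false m) x) ≡ x)
pathCycle-alternating-inverse zero = swap01-involutive , swap01-involutive
  where
  swap01-involutive : ∀ x → swap01 (swap01 x) ≡ x
  swap01-involutive zero       = refl
  swap01-involutive (suc zero) = refl
pathCycle-alternating-inverse (suc m) =
  insertAfter∘insertBefore _ _ (proj₂ (pathCycle-alternating-inverse m)) ,
  insertBefore∘insertAfter _ _ (proj₁ (pathCycle-alternating-inverse m))

findPre-unique : ∀ {k} (p : Perm k) {x y} l → (∀ a b → p a ≡ p b → a ≡ b) → p x ≡ y → x ∈ l → findPre p y l ≡ x
findPre-unique p {x} {y} (a ∷ l) p-inj px≡y x∈ with p a Fin.≟ y
... | yes pa≡y = p-inj a x (trans pa≡y (sym px≡y))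
... | no  pa≢y with x∈
...   | here refl = contradiction px≡y pa≢y
...   | there x∈l = findPre-unique p l p-inj px≡y x∈l

inverse-≗ : ∀ {k} (f g : Perm k) → (∀ x → g (f x) ≡ x) → (∀ x → f (g x) ≡ x) → inverse f ≗ g
inverse-≗ f g gf≗id fg≗id y = findPre-unique f (allFin _)
  (λ a b fa≡fb → trans (sym (gf≗id a)) (trans (cong g fa≡fb) (gf≗id b))) (fg≗id y) (∈-allFin (g y))

c0≗pathCycle : ∀ m → c0 (suc m) ≗ pathCycle (alternating false m)
c0≗pathCycle m = proj₁ (c0-pathCycle m)

inverse-c0≗pathCycle : ∀ m → inverse (c0 (suc m)) ≗ pathCycle (alternating true m)
inverse-c0≗pathCycle m = inverse-≗ (c0 (suc m)) (pathCycle (alternating true m))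
  (λ x → trans (cong (pathCycle (alternating true m)) (c0≗pathCycle m x)) (proj₂ (pathCycle-alternating-inverse m) x))
  (λ x → trans (c0≗pathCycle m _) (proj₁ (pathCycle-alternating-inverse m) x))

theorem3p11 : ∀ n → n ≥ 1 →
    Arises n (c0 n) × Arises n (inverse (c0 n)) ×
    mult n (inverse (c0 n)) ≡ mult n (c0 n) ×
    (∀ c → Arises n c → mult n c ≤ mult n (c0 n)) ×
    (∀ c → Arises n c → ¬ tabulate c ≡ tabulate (c0 n) → ¬ tabulate c ≡ tabulate (inverse (c0 n)) →
      mult n c < mult n (c0 n))
theorem3p11 (suc m) (s≤s z≤n) =
  mult-positive⇒arises n (c0 n) 0<mult-c0 ,
  mult-positive⇒arises n (inverse (c0 n)) (subst (0 <_) (sym mult-c0⁻¹) 0<mult-c0) ,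
  mult-c0⁻¹ ,
  (λ c arises → let s , c≗s = arises⇒pathCycle m {c} arises in
     subst₂ _≤_ (sym (mult≡total m s c≗s)) (sym mult-c0) (total-≤ s)) ,
  (λ c arises c≢c0 c≢c0⁻¹ → let s , c≗s = arises⇒pathCycle m {c} arises in
     subst₂ _<_ (sym (mult≡total m s c≗s)) (sym mult-c0) (total-non-alternating s c≗s c≢c0 c≢c0⁻¹))
  where
  n = suc m
  mult-c0 : mult n (c0 n) ≡ total (alternating false m)
  mult-c0 = mult≡total m (alternating false m) (c0≗pathCycle m)
  0<mult-c0 : 0 < mult n (c0 n)
  0<mult-c0 = subst (0 <_) (sym mult-c0) (∑α-positive m)
  mult-c0⁻¹ : mult n (inverse (c0 n)) ≡ mult n (c0 n)
  mult-c0⁻¹ = trans (mult≡total m (alternating true m) (inverse-c0≗pathCycle m)) (trans (∑β≡∑α m) (sym mult-c0))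
  total-non-alternating : ∀ {c} s → c ≗ pathCycle s → ¬ tabulate c ≡ tabulate (c0 n) → ¬ tabulate c ≡ tabulate (inverse (c0 n)) →
    total s < total (alternating false m)
  total-non-alternating s c≗s c≢c0 c≢c0⁻¹ with alternating-or-strict s
  ... | inj₁ refl        = contradiction (tabulate-cong (λ x → trans (c≗s x) (sym (c0≗pathCycle m x)))) c≢c0
  ... | inj₂ (inj₁ refl) = contradiction (tabulate-cong (λ x → trans (c≗s x) (sym (inverse-c0≗pathCycle m x)))) c≢c0⁻¹
  ... | inj₂ (inj₂ sd)   = total-< s sd
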